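{- Let $W$ be a finite Coxeter group. For every word $\mathbf{w}$ in the simple reflections, $D(T_{\mathbf{w}})=\sum_{u\in W}R_{u,\mathbf{w}}(q^{ -1})\,q^{ -\ell(u)}\,T_u$ in $\mathcal{H}_W$.
   Context: $\mathcal{H}_W$ is the $\mathbb{Z}[q^{\pm1}]$-algebra with basis $\{T_w\}$ and relations $T_wT_s=qT_{ws}+(q-1)T_w$ if $\ell(ws)<\ell(w)$, $T_wT_s=T_{ws}$ if $\ell(ws)>\ell(w)$. $T_{\mathbf{w}}=T_{s_1}\cdots T_{s_m}$ for $\mathbf{w}=(s_1,\dots,s_m)$. $D$ is the ring involution with $D(q)=q^{ -1}$, $D(T_w)=T_{w^{ -1}}^{ -1}$. $R_{u,\varnothing}=\delta_{u,e}$; $R_{u,\mathbf{w}\mathbf{s}}=R_{us,\mathbf{w}}$ if $\ell(us)<\ell(u)$, and $=qR_{us,\mathbf{w}}+(q-1)R_{u,\mathbf{w}}$ if $\ell(us)>\ell(u)$. -}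

module Defs where

open import Level using (0ℓ)
open import Algebra.Bundles using (Group; Ring; CommutativeRing)
open import Algebra.Morphism.Structures using (module GroupMorphisms; module RingMorphisms)
open import Data.Nat using (ℕ; zero; suc; _<_; _≤_; _<?_)
open import Data.Fin using (Fin)
open import Data.List using (List; []; _∷_; length; foldr; reverse)
open import Data.List.Relation.Unary.Any using (Any)
open import Data.List.Relation.Unary.All using (All)
open import Data.List.Relation.Unary.AllPairs using (AllPairs)
open import Data.Product using (Σ; ∃; _×_; _,_)
open import Relation.Nullary using (Dec; yes; no; ¬_)
open import Relation.Binary using (Decidable)
open import Relation.Binary.PropositionalEquality using (_≡_)

Word : ℕ → Set
Word r = List (Fin r)

gpow : (G : Group 0ℓ 0ℓ) → ℕ → Group.Carrier G → Group.Carrier G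
gpow G zero x = Group.ε G
gpow G (suc n) x = Group._∙_ G x (gpow G n x)

gword : (G : Group 0ℓ 0ℓ) {r : ℕ} → (Fin r → Group.Carrier G) → Word r → Group.Carrier G
gword G s = foldr (λ i x → Group._∙_ G (s i) x) (Group.ε G)

IsGroupHom : (G K : Group 0ℓ 0ℓ) → (Group.Carrier G → Group.Carrier K) → Set
IsGroupHom G K = GroupMorphisms.IsGroupHomomorphism (Group.rawGroup G) (Group.rawGroup K)

IsRingHom : (A B : Ring 0ℓ 0ℓ) → (Ring.Carrier A → Ring.Carrier B) → Set
IsRingHom A B = RingMorphisms.IsRingHomomorphism (Ring.rawRing A) (Ring.rawRing B)

IsCRingHom : (A B : CommutativeRing 0ℓ 0ℓ) → (CommutativeRing.Carrier A → CommutativeRing.Carrier B) → Set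
IsCRingHom A B = IsRingHom (CommutativeRing.ring A) (CommutativeRing.ring B)

-- W is the group with presentation ⟨ s_i | (s_i s_j)^{m_ij} = 1 ⟩, expressed
-- as: generated by the s_i, the relations hold, and every assignment of the
-- generators in any group satisfying the relations extends to a homomorphism.
record FiniteCoxeterSystem : Set₁ where
  field
    W : Group 0ℓ 0ℓ
  open Group W public
  field
    _≟_ : Decidable _≈_
    elements : List Carrier
    elements-complete : ∀ w → Any (w ≈_) elements
    elements-distinct : AllPairs (λ x y → ¬ x ≈ y) elements
    rank : ℕ
    s : Fin rank → Carrier
    m : Fin rank → Fin rank → ℕ
    m-diag : ∀ i → m i i ≡ 1
    m-sym : ∀ i j → m i j ≡ m j i
    m-off : ∀ i j → ¬ i ≡ j → 2 ≤ m i j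
    relations : ∀ i j → gpow W (m i j) (s i ∙ s j) ≈ ε
    generated : ∀ w → ∃ λ (v : Word rank) → gword W s v ≈ w
    presentation : (K : Group 0ℓ 0ℓ) (g : Fin rank → Group.Carrier K) →
      (∀ i j → Group._≈_ K (gpow K (m i j) (Group._∙_ K (g i) (g j))) (Group.ε K)) →
      Σ (Carrier → Group.Carrier K) λ φ → IsGroupHom W K φ × (∀ i → Group._≈_ K (φ (s i)) (g i))
    ℓ : Carrier → ℕ
    ℓ-attained : ∀ w → ∃ λ (v : Word rank) → gword W s v ≈ w × length v ≡ ℓ w
    ℓ-minimal : ∀ w (v : Word rank) → gword W s v ≈ w → ℓ w ≤ length v

-- The ring ℤ[q^{±1}], characterised by its universal property: the free
-- commutative ring on one invertible element q (with inverse q⁻¹).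
record LaurentRing : Set₁ where
  field
    Λ : CommutativeRing 0ℓ 0ℓ
  open CommutativeRing Λ public
  field
    q q⁻¹ : Carrier
    q-inv : q * q⁻¹ ≈ 1#
    lift : (B : CommutativeRing 0ℓ 0ℓ) (b b' : CommutativeRing.Carrier B) →
      CommutativeRing._≈_ B (CommutativeRing._*_ B b b') (CommutativeRing.1# B) →
      Σ (Carrier → CommutativeRing.Carrier B) λ f → IsCRingHom Λ B f × CommutativeRing._≈_ B (f q) b
    lift-unique : (B : CommutativeRing 0ℓ 0ℓ) (f g : Carrier → CommutativeRing.Carrier B) →
      IsCRingHom Λ B f → IsCRingHom Λ B g → CommutativeRing._≈_ B (f q) (g q) →
      ∀ x → CommutativeRing._≈_ B (f x) (g x)

lpow : (L : LaurentRing) → ℕ → LaurentRing.Carrier L → LaurentRing.Carrier L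
lpow L zero x = LaurentRing.1# L
lpow L (suc n) x = LaurentRing._*_ L x (lpow L n x)

-- The Iwahori–Hecke algebra H_W: a ℤ[q^{±1}]-algebra (ring H with a ring
-- map ι : Λ → H with central image) with Λ-basis {T_w | w ∈ W} and the
-- multiplication rules T_w T_s = q T_{ws} + (q-1) T_w  (ℓ(ws) < ℓ(w)),
-- T_w T_s = T_{ws} (ℓ(ws) > ℓ(w)); T_e is the unit.
module _ (C : FiniteCoxeterSystem) (L : LaurentRing) where
  private
    module C = FiniteCoxeterSystem C
    module L = LaurentRing L

  record HeckeAlgebra : Set₁ where
    field
      H : Ring 0ℓ 0ℓ
    open Ring H public
    sumW : (C.Carrier → Carrier) → Carrier
    sumW f = foldr (λ u x → f u + x) 0# C.elements
    field
      ι : L.Carrier → Carrier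
      ι-hom : IsRingHom L.ring H ι
      ι-central : ∀ a h → ι a * h ≈ h * ι a
      T : C.Carrier → Carrier
      T-cong : ∀ {u v} → u C.≈ v → T u ≈ T v
      T-unit : T C.ε ≈ 1#
      T-short : ∀ w i → C.ℓ (w C.∙ C.s i) < C.ℓ w →
        T w * T (C.s i) ≈ ι L.q * T (w C.∙ C.s i) + ι (L.q L.+ L.- L.1#) * T w
      T-long : ∀ w i → C.ℓ w < C.ℓ (w C.∙ C.s i) →
        T w * T (C.s i) ≈ T (w C.∙ C.s i)
      basis-span : ∀ h → ∃ λ (c : C.Carrier → L.Carrier) → h ≈ sumW (λ u → ι (c u) * T u)
      basis-indep : ∀ (c c' : C.Carrier → L.Carrier) →
        sumW (λ u → ι (c u) * T u) ≈ sumW (λ u → ι (c' u) * T u) →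
        All (λ u → c u L.≈ c' u) C.elements

    Tword : Word C.rank → Carrier
    Tword = foldr (λ i x → T (C.s i) * x) 1#

  -- The ring involution D of H_W: D(q) = q⁻¹, D(T_w) = (T_{w⁻¹})⁻¹.
  record BarInvolution (HA : HeckeAlgebra) : Set where
    open HeckeAlgebra HA
    field
      D : Carrier → Carrier
      D-hom : IsRingHom H H D
      D-invol : ∀ h → D (D h) ≈ h
      D-q : D (ι L.q) ≈ ι L.q⁻¹
      D-T-left : ∀ w → D (T w) * T (w C.⁻¹) ≈ 1#
      D-T-right : ∀ w → T (w C.⁻¹) * D (T w) ≈ 1#

  -- R_{u,𝐰}(x): value at x of the polynomial R_{u,𝐰} ∈ ℤ[q], computed by the
  -- defining recursion with q replaced by x (evaluation is a ring map).
  -- Rrev works on the reversed word, so that the last letter is peeled off.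
  Rrev : L.Carrier → C.Carrier → Word C.rank → L.Carrier
  Rrev x u [] with u C.≟ C.ε
  ... | yes _ = L.1#
  ... | no _ = L.0#
  Rrev x u (i ∷ rw) with C.ℓ (u C.∙ C.s i) <? C.ℓ u
  ... | yes _ = Rrev x (u C.∙ C.s i) rw
  ... | no _ = x L.* Rrev x (u C.∙ C.s i) rw L.+ (x L.+ L.- L.1#) L.* Rrev x u rw

  R : L.Carrier → C.Carrier → Word C.rank → L.Carrier
  R x u w = Rrev x u (reverse w)

-- Since D is a ring map, D(T_𝐰 T_s) = D(T_𝐰) D(T_s), and
-- D(T_s) = T_s⁻¹ = q⁻¹ T_s + (q⁻¹ - 1) by the quadratic relation. Right
-- multiplication by T_s⁻¹ sends T_u to T_{us} when us < u and to
-- q⁻¹ T_{us} + (q⁻¹ - 1) T_u when us > u; after reindexing the sum along the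
-- involution u ↦ us, the new coefficient of T_v is exactly the recursion
-- defining R_{v,𝐰s}(q⁻¹), because ℓ(vs) = ℓ(v) ± 1 accounts for the power of q⁻¹.
-- That ℓ(us) ≠ ℓ(u) comes from the sign character W → ℤ/2, s ↦ 1.
module Submission where

open import Level using (Level; 0ℓ)
open import Algebra.Bundles using (Group; Semiring; Ring)
open import Algebra.Morphism.Structures using (module GroupMorphisms; module RingMorphisms)
import Algebra.Properties.Group as GroupProperties
import Algebra.Properties.Monoid as MonoidProperties
import Algebra.Properties.Ring as RingProperties
open import Data.Fin.Base using (Fin)
open import Data.List.Base using (List; []; _∷_; _++_; foldr; map; length; reverse)
open import Data.List.Properties using (foldr-map; length-++; unfold-reverse; reverse-involutive)
import Data.List.Membership.Setoid as Membership
open import Data.List.Membership.Setoid.Properties using (∈-∃++; ∈-resp-≈; ∈-map⁺; All[≉]⇒∉)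
import Data.List.Relation.Binary.Equality.Setoid as SetoidEquality
import Data.List.Relation.Binary.Permutation.Setoid as Permutation
import Data.List.Relation.Binary.Permutation.Setoid.Properties as PermutationProperties
import Data.List.Relation.Binary.Subset.Setoid as Subset
open import Data.List.Relation.Unary.All as All using (All; []; _∷_)
open import Data.List.Relation.Unary.Any using (here; there)
open import Data.List.Relation.Unary.AllPairs as AllPairs using (_∷_)
import Data.List.Relation.Unary.AllPairs.Properties as AllPairsₚ
import Data.List.Relation.Unary.Unique.Setoid as Unique
open import Data.Nat.Base using (ℕ; zero; suc; _<_; _≤_; parity)
open import Data.Nat.Properties as ℕₚ
  using (_<?_; ≤-antisym; ≤-reflexive; <-asym; ≮⇒≥; ≤∧≢⇒<; n≤0⇒n≡0; n≮0)
open import Data.Parity.Base as ℙ using (Parity; 1ℙ)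
import Data.Parity.Properties as ℙₚ
open import Data.Product.Base using (Σ; _×_; _,_; proj₁; proj₂)
open import Function.Base using (_∘_)
open import Relation.Binary.Bundles using (Setoid)
open import Relation.Binary.Core using (_Preserves_⟶_)
import Relation.Binary.PropositionalEquality as ≡
open import Relation.Binary.PropositionalEquality using (_≡_; _≢_)
open import Relation.Nullary using (Dec; yes; no; ¬_)
open import Relation.Nullary.Negation using (contradiction)

open import Defs

gpow-ε : (G : Group 0ℓ 0ℓ) → ∀ n → Group._≈_ G (gpow G n (Group.ε G)) (Group.ε G)
gpow-ε G zero = Group.refl G
gpow-ε G (suc n) = Group.trans G (Group.identityˡ G _) (gpow-ε G n)

module _ {c ℓ : Level} (R : Ring c ℓ) where
  open Ring R
  open RingProperties R using (-‿distribʳ-*)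
  open import Relation.Binary.Reasoning.Setoid setoid

  y*[x-1]+[y-1]≈0 : ∀ {x y} → y * x ≈ 1# → y * (x + - 1#) + (y + - 1#) ≈ 0#
  y*[x-1]+[y-1]≈0 {x} {y} yx≈1 = begin
    y * (x + - 1#) + (y + - 1#)     ≈⟨ +-congʳ (distribˡ y x (- 1#)) ⟩
    (y * x + y * - 1#) + (y + - 1#) ≈⟨ +-congʳ (+-cong yx≈1 y*-1≈-y) ⟩
    (1# + - y) + (y + - 1#)         ≈⟨ +-assoc 1# (- y) (y + - 1#) ⟩
    1# + (- y + (y + - 1#))         ≈⟨ +-congˡ (sym (+-assoc (- y) y (- 1#))) ⟩
    1# + ((- y + y) + - 1#)         ≈⟨ +-congˡ (trans (+-congʳ (-‿inverseˡ y)) (+-identityˡ (- 1#))) ⟩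
    1# + - 1#                       ≈⟨ -‿inverseʳ 1# ⟩
    0#                              ∎
    where
    y*-1≈-y : y * - 1# ≈ - y
    y*-1≈-y = trans (sym (-‿distribʳ-* y 1#)) (-‿cong (*-identityʳ y))

module _ {a ℓ : Level} (S : Setoid a ℓ) where
  open Setoid S
  open Membership S using (_∈_)
  open Subset S using (_⊆_)
  open Unique S using (Unique; head; tail)
  open Permutation S using (_↭_; prep; ↭-refl; ↭-sym; ↭-trans)
  open PermutationProperties S using (↭-shift; ↭-respˡ-≋; ∈-resp-↭; Unique-resp-↭)
  open SetoidEquality S using (≋-sym)

  unique-⊆-↭ : ∀ {xs ys} → Unique xs → Unique ys → xs ⊆ ys → ys ⊆ xs → xs ↭ ys
  unique-⊆-↭ {[]} {[]} _ _ _ _ = ↭-refl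
  unique-⊆-↭ {[]} {y ∷ ys} _ _ _ ys⊆[] with () ← ys⊆[] (here refl)
  unique-⊆-↭ {x ∷ xs} {ys} (x∉xs ∷ xs!) ys! xs⊆ys ys⊆xs
    with as , bs , y , x≈y , ys≋ ← ∈-∃++ S (xs⊆ys (here refl)) =
    ↭-trans (prep x≈y (unique-⊆-↭ xs! rest! xs⊆rest rest⊆xs)) (↭-sym ys↭)
    where
    ys↭ : ys ↭ y ∷ as ++ bs
    ys↭ = ↭-respˡ-≋ (≋-sym ys≋) (↭-shift as bs)
    y∷rest! : Unique (y ∷ as ++ bs)
    y∷rest! = Unique-resp-↭ ys↭ ys!
    rest! = tail y∷rest!
    xs⊆rest : xs ⊆ as ++ bs
    xs⊆rest z∈xs with ∈-resp-↭ ys↭ (xs⊆ys (there z∈xs))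
    ... | here z≈y = contradiction (∈-resp-≈ S (trans z≈y (sym x≈y)) z∈xs) (All[≉]⇒∉ S x∉xs)
    ... | there z∈rest = z∈rest
    rest⊆xs : as ++ bs ⊆ xs
    rest⊆xs z∈rest with ys⊆xs (∈-resp-↭ (↭-sym ys↭) (there z∈rest))
    ... | here z≈x = contradiction (∈-resp-≈ S (trans z≈x x≈y) z∈rest) (All[≉]⇒∉ S (head y∷rest!))
    ... | there z∈xs = z∈xs

module FiniteSums {a ℓ₁ c ℓ₂ : Level} (S : Setoid a ℓ₁) (R : Semiring c ℓ₂) where
  open Setoid S using () renaming (Carrier to A; _≈_ to _≃_; trans to ≃-trans; sym to ≃-sym)
  open Semiring R
  open Membership S using (_∈_)
  open Unique S using (Unique)
  open Permutation S using (_↭_)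
  open import Relation.Binary.Reasoning.Setoid setoid

  sum : (A → Carrier) → List A → Carrier
  sum F = foldr (λ u x → F u + x) 0#

  sum-cong : ∀ {F G} → (∀ u → F u ≈ G u) → ∀ xs → sum F xs ≈ sum G xs
  sum-cong F≈G [] = refl
  sum-cong F≈G (x ∷ xs) = +-cong (F≈G x) (sum-cong F≈G xs)

  sum-distrib-+ : ∀ F G xs → sum F xs + sum G xs ≈ sum (λ u → F u + G u) xs
  sum-distrib-+ F G [] = +-identityʳ 0#
  sum-distrib-+ F G (x ∷ xs) = begin
    (F x + sum F xs) + (G x + sum G xs) ≈⟨ +-assoc _ _ _ ⟩
    F x + (sum F xs + (G x + sum G xs)) ≈⟨ +-congˡ (+-comm (sum F xs) _) ⟩
    F x + ((G x + sum G xs) + sum F xs) ≈⟨ +-congˡ (+-assoc _ _ _) ⟩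
    F x + (G x + (sum G xs + sum F xs)) ≈⟨ sym (+-assoc _ _ _) ⟩
    (F x + G x) + (sum G xs + sum F xs) ≈⟨ +-congˡ (+-comm (sum G xs) _) ⟩
    (F x + G x) + (sum F xs + sum G xs) ≈⟨ +-congˡ (sum-distrib-+ F G xs) ⟩
    (F x + G x) + sum (λ u → F u + G u) xs ∎

  *-distribʳ-sum : ∀ F y xs → sum F xs * y ≈ sum (λ u → F u * y) xs
  *-distribʳ-sum F y [] = zeroˡ y
  *-distribʳ-sum F y (x ∷ xs) = trans (distribʳ y _ _) (+-congˡ (*-distribʳ-sum F y xs))

  sum-zero : ∀ {F xs} → All (λ u → F u ≈ 0#) xs → sum F xs ≈ 0#
  sum-zero [] = refl
  sum-zero (Fx≈0 ∷ Fxs≈0) = trans (+-cong Fx≈0 (sum-zero Fxs≈0)) (+-identityʳ 0#)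

  sum-map : ∀ F (f : A → A) xs → sum F (map f xs) ≡ sum (F ∘ f) xs
  sum-map F f = foldr-map _ f 0#

  sum-↭ : ∀ {F xs ys} → F Preserves _≃_ ⟶ _≈_ → xs ↭ ys → sum F xs ≈ sum F ys
  sum-↭ {F} {xs} {ys} F-resp xs↭ys = begin
    sum F xs                ≡⟨ ≡.sym (foldr-map _+_ F 0# xs) ⟩
    foldr _+_ 0# (map F xs) ≈⟨ PermutationProperties.foldr-commMonoid setoid +-isCommutativeMonoid
                                 (PermutationProperties.map⁺ S setoid F-resp xs↭ys) ⟩
    foldr _+_ 0# (map F ys) ≡⟨ foldr-map _+_ F 0# ys ⟩
    sum F ys                ∎

  sum-unique-support : ∀ {F x} → F Preserves _≃_ ⟶ _≈_ → (∀ {y} → ¬ x ≃ y → F y ≈ 0#) →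
    ∀ {xs} → Unique xs → x ∈ xs → sum F xs ≈ F x
  sum-unique-support {F} {x} F-resp off-x {y ∷ xs} (y∉xs ∷ _) (here x≃y) = begin
    F y + sum F xs ≈⟨ +-cong (sym (F-resp x≃y)) (sum-zero (All.map (λ y≄z → off-x (y≄z ∘ ≃-trans (≃-sym x≃y))) y∉xs)) ⟩
    F x + 0#      ≈⟨ +-identityʳ (F x) ⟩
    F x           ∎
  sum-unique-support {F} {x} F-resp off-x {y ∷ xs} (y∉xs ∷ xs!) (there x∈xs) = begin
    F y + sum F xs ≈⟨ +-cong (off-x x≄y) (sum-unique-support F-resp off-x xs! x∈xs) ⟩
    0# + F x       ≈⟨ +-identityˡ (F x) ⟩
    F x            ∎
    where
    x≄y : ¬ x ≃ y
    x≄y x≃y = All[≉]⇒∉ S y∉xs (∈-resp-≈ S x≃y x∈xs)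

module CoxeterProperties (C : FiniteCoxeterSystem) where
  open FiniteCoxeterSystem C
  open GroupProperties W using (inverseʳ-unique; ∙-cancelʳ)
  open Membership setoid using (_∈_)
  open Subset setoid using (_⊆_)
  open Permutation setoid using (_↭_)

  s-square : ∀ i → s i ∙ s i ≈ ε
  s-square i = trans (sym (identityʳ _))
    (≡.subst (λ n → gpow W n (s i ∙ s i) ≈ ε) (m-diag i) (relations i i))

  s-self-inverse : ∀ i → s i ⁻¹ ≈ s i
  s-self-inverse i = sym (inverseʳ-unique (s i) (s i) (s-square i))

  ∙s-involutive : ∀ u i → (u ∙ s i) ∙ s i ≈ u
  ∙s-involutive u i = trans (assoc u (s i) (s i)) (trans (∙-congˡ (s-square i)) (identityʳ u))

  ∙ʳ-permutes-elements : ∀ g → map (_∙ g) elements ↭ elements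
  ∙ʳ-permutes-elements g =
    unique-⊆-↭ setoid distinct elements-distinct (λ _ → elements-complete _) covered
    where
    distinct = AllPairsₚ.map⁺ (AllPairs.map (λ x≉y → x≉y ∘ ∙-cancelʳ g _ _) elements-distinct)
    covered : elements ⊆ map (_∙ g) elements
    covered {z} _ = ∈-resp-≈ setoid z∙g⁻¹∙g≈z (∈-map⁺ setoid setoid ∙-congʳ (elements-complete (z ∙ g ⁻¹)))
      where
      z∙g⁻¹∙g≈z : (z ∙ g ⁻¹) ∙ g ≈ z
      z∙g⁻¹∙g≈z = trans (assoc z (g ⁻¹) g) (trans (∙-congˡ (inverseˡ g)) (identityʳ z))

  ℓ-≤-cong : ∀ {u v} → u ≈ v → ℓ v ≤ ℓ u
  ℓ-≤-cong {u} {v} u≈v with a , a≈u , |a|≡ℓu ← ℓ-attained u =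
    ≡.subst (ℓ v ≤_) |a|≡ℓu (ℓ-minimal v a (trans a≈u u≈v))

  ℓ-cong : ∀ {u v} → u ≈ v → ℓ u ≡ ℓ v
  ℓ-cong u≈v = ≤-antisym (ℓ-≤-cong (sym u≈v)) (ℓ-≤-cong u≈v)

  ℓ-ε : ℓ ε ≡ 0
  ℓ-ε = n≤0⇒n≡0 (ℓ-minimal ε [] refl)

  gword-∷ʳ : ∀ v i → gword W s (v ++ i ∷ []) ≈ gword W s v ∙ s i
  gword-∷ʳ [] i = trans (identityʳ (s i)) (sym (identityˡ (s i)))
  gword-∷ʳ (j ∷ v) i = trans (∙-congˡ (gword-∷ʳ v i)) (sym (assoc (s j) _ (s i)))

  ℓ-∙s-≤ : ∀ u i → ℓ (u ∙ s i) ≤ suc (ℓ u)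
  ℓ-∙s-≤ u i with a , a≈u , |a|≡ℓu ← ℓ-attained u =
    ≡.subst (ℓ (u ∙ s i) ≤_) |a++i|≡1+ℓu (ℓ-minimal (u ∙ s i) (a ++ i ∷ []) (trans (gword-∷ʳ a i) (∙-congʳ a≈u)))
    where
    |a++i|≡1+ℓu : length (a ++ i ∷ []) ≡ suc (ℓ u)
    |a++i|≡1+ℓu = ≡.trans (length-++ a) (≡.trans (ℕₚ.+-comm (length a) 1) (≡.cong suc |a|≡ℓu))

  private
    sign-character : Σ (Carrier → Parity) λ φ → IsGroupHom W ℙₚ.+-0-group φ × (∀ i → φ (s i) ≡ 1ℙ)
    sign-character = presentation ℙₚ.+-0-group (λ _ → 1ℙ) (λ i j → gpow-ε ℙₚ.+-0-group (m i j))

    sign : Carrier → Parity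
    sign = proj₁ sign-character

    module sign = GroupMorphisms.IsGroupHomomorphism (proj₁ (proj₂ sign-character))

    sign-s : ∀ i → sign (s i) ≡ 1ℙ
    sign-s = proj₂ (proj₂ sign-character)

    sign-gword : ∀ v → sign (gword W s v) ≡ parity (length v)
    sign-gword [] = sign.ε-homo
    sign-gword (j ∷ v) = ≡.trans (sign.homo (s j) _)
      (≡.trans (≡.cong₂ ℙ._+_ (sign-s j) (sign-gword v)) (ℙₚ.⁻¹-selfInverse (ℙₚ.suc-homo-⁻¹ (length v))))

    sign-ℓ : ∀ u → sign u ≡ parity (ℓ u)
    sign-ℓ u with a , a≈u , |a|≡ℓu ← ℓ-attained u =
      ≡.trans (sign.⟦⟧-cong (sym a≈u)) (≡.trans (sign-gword a) (≡.cong parity |a|≡ℓu))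

  ℓ-∙s-≢ : ∀ u i → ℓ (u ∙ s i) ≢ ℓ u
  ℓ-∙s-≢ u i ℓus≡ℓu = ℙₚ.p≢p⁻¹ (sign u) (begin
    sign u               ≡⟨ sign-ℓ u ⟩
    parity (ℓ u)         ≡⟨ ≡.cong parity ℓus≡ℓu ⟨
    parity (ℓ (u ∙ s i)) ≡⟨ sign-ℓ (u ∙ s i) ⟨
    sign (u ∙ s i)       ≡⟨ sign.homo u (s i) ⟩
    sign u ℙ.+ sign (s i) ≡⟨ ≡.cong (sign u ℙ.+_) (sign-s i) ⟩
    sign u ℙ.+ 1ℙ        ≡⟨ ℙₚ.+-comm (sign u) 1ℙ ⟩
    sign u ℙ.⁻¹          ∎)
    where open ≡.≡-Reasoning

  IsDescent : Fin rank → Carrier → Set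
  IsDescent i u = ℓ (u ∙ s i) < ℓ u

  descent? : ∀ i u → Dec (IsDescent i u)
  descent? i u = ℓ (u ∙ s i) <? ℓ u

  IsDescent-resp : ∀ {i u v} → u ≈ v → IsDescent i u → IsDescent i v
  IsDescent-resp u≈v = ≡.subst₂ _<_ (ℓ-cong (∙-congʳ u≈v)) (ℓ-cong u≈v)

  ℓ-descent : ∀ {i u} → IsDescent i u → ℓ u ≡ suc (ℓ (u ∙ s i))
  ℓ-descent {i} {u} d =
    ≤-antisym (≡.subst (_≤ suc (ℓ (u ∙ s i))) (ℓ-cong (∙s-involutive u i)) (ℓ-∙s-≤ (u ∙ s i) i)) d

  ℓ-ascent : ∀ {i u} → ¬ IsDescent i u → ℓ (u ∙ s i) ≡ suc (ℓ u)
  ℓ-ascent {i} {u} ¬d = ≤-antisym (ℓ-∙s-≤ u i) (≤∧≢⇒< (≮⇒≥ ¬d) (ℓ-∙s-≢ u i ∘ ≡.sym))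

  ascent-< : ∀ {i u} → ¬ IsDescent i u → ℓ u < ℓ (u ∙ s i)
  ascent-< ¬d = ≤-reflexive (≡.sym (ℓ-ascent ¬d))

  ascent⇒descent : ∀ {i u} → ¬ IsDescent i u → IsDescent i (u ∙ s i)
  ascent⇒descent {i} {u} ¬d = ≡.subst (_< ℓ (u ∙ s i)) (≡.sym (ℓ-cong (∙s-involutive u i))) (ascent-< ¬d)

  descent⇒ascent : ∀ {i u} → IsDescent i u → ¬ IsDescent i (u ∙ s i)
  descent⇒ascent {i} {u} d d′ = <-asym d (≡.subst (_< ℓ (u ∙ s i)) (ℓ-cong (∙s-involutive u i)) d′)

  s-descent : ∀ i → IsDescent i (s i)
  s-descent i = IsDescent-resp (identityˡ (s i)) (ascent⇒descent ε-ascent)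
    where
    ε-ascent : ¬ IsDescent i ε
    ε-ascent d = n≮0 (≡.subst (ℓ (ε ∙ s i) <_) ℓ-ε d)

module Coefficients (C : FiniteCoxeterSystem) (L : LaurentRing) where
  private
    module C = FiniteCoxeterSystem C
    module L = LaurentRing L
  open CoxeterProperties C
  open import Relation.Binary.Reasoning.Setoid L.setoid
  open import Algebra.Solver.Ring.NaturalCoefficients.Default L.commutativeSemiring

  module _ {x : L.Carrier} where
    Rrev-ε : ∀ {u} → u C.≈ C.ε → Rrev C L x u [] ≡ L.1#
    Rrev-ε {u} u≈ε with u C.≟ C.ε
    ... | yes _ = ≡.refl
    ... | no u≉ε = contradiction u≈ε u≉ε

    Rrev-≉ε : ∀ {u} → ¬ u C.≈ C.ε → Rrev C L x u [] ≡ L.0#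
    Rrev-≉ε {u} u≉ε with u C.≟ C.ε
    ... | yes u≈ε = contradiction u≈ε u≉ε
    ... | no _ = ≡.refl

    Rrev-descent : ∀ {u i rw} → IsDescent i u → Rrev C L x u (i ∷ rw) ≡ Rrev C L x (u C.∙ C.s i) rw
    Rrev-descent {u} {i} d with descent? i u
    ... | yes _ = ≡.refl
    ... | no ¬d = contradiction d ¬d

    Rrev-ascent : ∀ {u i rw} → ¬ IsDescent i u →
      Rrev C L x u (i ∷ rw) ≡ x L.* Rrev C L x (u C.∙ C.s i) rw L.+ (x L.+ L.- L.1#) L.* Rrev C L x u rw
    Rrev-ascent {u} {i} ¬d with descent? i u
    ... | yes d = contradiction d ¬d
    ... | no _ = ≡.refl

    Rrev-cong : ∀ rw {u v} → u C.≈ v → Rrev C L x u rw L.≈ Rrev C L x v rw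
    Rrev-cong [] {u} {v} u≈v with u C.≟ C.ε
    ... | yes u≈ε = L.reflexive (≡.sym (Rrev-ε (C.trans (C.sym u≈v) u≈ε)))
    ... | no u≉ε = L.reflexive (≡.sym (Rrev-≉ε (u≉ε ∘ C.trans u≈v)))
    Rrev-cong (i ∷ rw) {u} {v} u≈v with descent? i u
    ... | yes d = begin
      Rrev C L x (u C.∙ C.s i) rw   ≈⟨ Rrev-cong rw (C.∙-congʳ u≈v) ⟩
      Rrev C L x (v C.∙ C.s i) rw   ≡⟨ Rrev-descent (IsDescent-resp u≈v d) ⟨
      Rrev C L x v (i ∷ rw)         ∎
    ... | no ¬d = begin
      x L.* Rrev C L x (u C.∙ C.s i) rw L.+ (x L.+ L.- L.1#) L.* Rrev C L x u rw
        ≈⟨ L.+-cong (L.*-congˡ (Rrev-cong rw (C.∙-congʳ u≈v))) (L.*-congˡ (Rrev-cong rw u≈v)) ⟩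
      x L.* Rrev C L x (v C.∙ C.s i) rw L.+ (x L.+ L.- L.1#) L.* Rrev C L x v rw
        ≡⟨ Rrev-ascent (¬d ∘ IsDescent-resp (C.sym u≈v)) ⟨
      Rrev C L x v (i ∷ rw)         ∎

  q⁻^ : ℕ → L.Carrier
  q⁻^ n = lpow L n L.q⁻¹

  -- The coefficient of T_u in D(T_𝐰), indexed by the reversed word.
  coefficient : List (Fin C.rank) → C.Carrier → L.Carrier
  coefficient rw u = Rrev C L L.q⁻¹ u rw L.* q⁻^ (C.ℓ u)

  coefficient-cong : ∀ rw {u v} → u C.≈ v → coefficient rw u L.≈ coefficient rw v
  coefficient-cong rw u≈v = L.*-cong (Rrev-cong rw u≈v) (L.reflexive (≡.cong q⁻^ (ℓ-cong u≈v)))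

  coefficient-[]-ε : coefficient [] C.ε L.≈ L.1#
  coefficient-[]-ε = L.trans (L.reflexive (≡.cong₂ L._*_ (Rrev-ε {L.q⁻¹} C.refl) (≡.cong q⁻^ ℓ-ε))) (L.*-identityʳ L.1#)

  coefficient-[]-≉ε : ∀ {u} → ¬ u C.≈ C.ε → coefficient [] u L.≈ L.0#
  coefficient-[]-≉ε {u} u≉ε = L.trans (L.reflexive (≡.cong (L._* q⁻^ (C.ℓ u)) (Rrev-≉ε {L.q⁻¹} u≉ε))) (L.zeroˡ _)

  -- T_u D(T_s) = α T_{us} + β T_u, according to whether s is a right descent of u.
  α : ∀ {P : Set} → Dec P → L.Carrier
  α (yes _) = L.1#
  α (no _) = L.q⁻¹

  β : ∀ {P : Set} → Dec P → L.Carrier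
  β (yes _) = L.0#
  β (no _) = L.q⁻¹ L.+ L.- L.1#

  α-cong : ∀ i {u v} → u C.≈ v → α (descent? i u) ≡ α (descent? i v)
  α-cong i u≈v = ≡.cong₂ (λ m n → α (m <? n)) (ℓ-cong (C.∙-congʳ u≈v)) (ℓ-cong u≈v)

  coefficient-step : ∀ i rw v →
    coefficient rw (v C.∙ C.s i) L.* α (descent? i (v C.∙ C.s i)) L.+ coefficient rw v L.* β (descent? i v)
      L.≈ coefficient (i ∷ rw) v
  coefficient-step i rw v = by-descent (descent? i v) (descent? i vs)
    where
    vs = v C.∙ C.s i
    Rvs = Rrev C L L.q⁻¹ vs rw
    Rv = Rrev C L L.q⁻¹ v rw
    by-descent : (d : Dec (IsDescent i v)) (d′ : Dec (IsDescent i vs)) →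
      coefficient rw vs L.* α d′ L.+ coefficient rw v L.* β d L.≈ coefficient (i ∷ rw) v
    by-descent (yes d) (yes d′) = contradiction d′ (descent⇒ascent d)
    by-descent (no ¬d) (no ¬d′) = contradiction (ascent⇒descent ¬d) ¬d′
    by-descent (yes d) (no _) = begin
      Rvs L.* q⁻^ (C.ℓ vs) L.* L.q⁻¹ L.+ coefficient rw v L.* L.0#
        ≈⟨ L.trans (L.+-congˡ (L.zeroʳ _)) (L.+-identityʳ _) ⟩
      Rvs L.* q⁻^ (C.ℓ vs) L.* L.q⁻¹   ≈⟨ L.trans (L.*-assoc _ _ _) (L.*-congˡ (L.*-comm _ _)) ⟩
      Rvs L.* q⁻^ (suc (C.ℓ vs))        ≡⟨ ≡.cong (λ n → Rvs L.* q⁻^ n) (ℓ-descent d) ⟨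
      Rvs L.* q⁻^ (C.ℓ v)               ≡⟨ ≡.cong (L._* q⁻^ (C.ℓ v)) (Rrev-descent d) ⟨
      coefficient (i ∷ rw) v            ∎
    by-descent (no ¬d) (yes _) = begin
      Rvs L.* q⁻^ (C.ℓ vs) L.* L.1# L.+ Rv L.* q⁻^ (C.ℓ v) L.* b
        ≈⟨ L.+-congʳ (L.*-identityʳ _) ⟩
      Rvs L.* q⁻^ (C.ℓ vs) L.+ Rv L.* q⁻^ (C.ℓ v) L.* b
        ≡⟨ ≡.cong (λ n → Rvs L.* q⁻^ n L.+ Rv L.* q⁻^ (C.ℓ v) L.* b) (ℓ-ascent ¬d) ⟩
      Rvs L.* (L.q⁻¹ L.* q⁻^ (C.ℓ v)) L.+ Rv L.* q⁻^ (C.ℓ v) L.* b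
        ≈⟨ solve 5 (λ r₁ r₂ p x y → r₁ :* (x :* p) :+ r₂ :* p :* y := (x :* r₁ :+ y :* r₂) :* p)
                   L.refl Rvs Rv (q⁻^ (C.ℓ v)) L.q⁻¹ b ⟩
      (L.q⁻¹ L.* Rvs L.+ b L.* Rv) L.* q⁻^ (C.ℓ v)
        ≡⟨ ≡.cong (L._* q⁻^ (C.ℓ v)) (Rrev-ascent ¬d) ⟨
      coefficient (i ∷ rw) v ∎
      where
      b = L.q⁻¹ L.+ L.- L.1#

module HeckeQuadratic (C : FiniteCoxeterSystem) (L : LaurentRing) (HA : HeckeAlgebra C L) where
  private
    module C = FiniteCoxeterSystem C
    module L = LaurentRing L
    module ι = RingMorphisms.IsRingHomomorphism (HeckeAlgebra.ι-hom HA)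
  open HeckeAlgebra HA
  open CoxeterProperties C
  open import Relation.Binary.Reasoning.Setoid setoid

  ι-cong : ∀ {a b} → a L.≈ b → ι a ≈ ι b
  ι-cong = ι.⟦⟧-cong

  *-ι-comm : ∀ x a y → x * (ι a * y) ≈ ι a * (x * y)
  *-ι-comm x a y = trans (sym (*-assoc x _ y)) (trans (*-congʳ (sym (ι-central a x))) (*-assoc _ x y))

  ι-*-assoc : ∀ a b x → ι a * (ι b * x) ≈ ι (a L.* b) * x
  ι-*-assoc a b x = trans (sym (*-assoc _ _ x)) (*-congʳ (sym (ι.*-homo a b)))

  T-s-square : ∀ i → T (C.s i) * T (C.s i) ≈ ι L.q + ι (L.q L.+ L.- L.1#) * T (C.s i)
  T-s-square i = begin
    T (C.s i) * T (C.s i)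
      ≈⟨ T-short (C.s i) i (s-descent i) ⟩
    ι L.q * T (C.s i C.∙ C.s i) + ι (L.q L.+ L.- L.1#) * T (C.s i)
      ≈⟨ +-congʳ (trans (*-congˡ (trans (T-cong (s-square i)) T-unit)) (*-identityʳ _)) ⟩
    ι L.q + ι (L.q L.+ L.- L.1#) * T (C.s i) ∎

  T-s⁻¹ : Fin C.rank → Carrier
  T-s⁻¹ i = ι L.q⁻¹ * T (C.s i) + ι (L.q⁻¹ L.+ L.- L.1#)

  T-s-*-T-s⁻¹ : ∀ i → T (C.s i) * T-s⁻¹ i ≈ 1#
  T-s-*-T-s⁻¹ i = begin
    t * (ι a * t + ι b)                    ≈⟨ distribˡ t _ _ ⟩
    t * (ι a * t) + t * ι b                ≈⟨ +-cong (*-ι-comm t a t) (sym (ι-central b t)) ⟩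
    ι a * (t * t) + ι b * t                ≈⟨ +-congʳ (*-congˡ (T-s-square i)) ⟩
    ι a * (ι L.q + ι c * t) + ι b * t      ≈⟨ +-congʳ (distribˡ (ι a) _ _) ⟩
    (ι a * ι L.q + ι a * (ι c * t)) + ι b * t
      ≈⟨ +-assoc _ _ _ ⟩
    ι a * ι L.q + (ι a * (ι c * t) + ι b * t)
      ≈⟨ +-cong (sym (ι.*-homo a L.q)) (+-congʳ (ι-*-assoc a c t)) ⟩
    ι (a L.* L.q) + (ι (a L.* c) * t + ι b * t)
      ≈⟨ +-congˡ (trans (sym (distribʳ t _ _)) (*-congʳ (sym (ι.+-homo _ b)))) ⟩
    ι (a L.* L.q) + ι (a L.* c L.+ b) * t
      ≈⟨ +-cong (ι-cong q⁻¹q≈1) (*-congʳ (ι-cong (y*[x-1]+[y-1]≈0 L.ring q⁻¹q≈1))) ⟩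
    ι L.1# + ι L.0# * t                    ≈⟨ +-cong ι.1#-homo (trans (*-congʳ ι.0#-homo) (zeroˡ t)) ⟩
    1# + 0#                                ≈⟨ +-identityʳ 1# ⟩
    1#                                     ∎
    where
    t = T (C.s i)
    a = L.q⁻¹
    b = L.q⁻¹ L.+ L.- L.1#
    c = L.q L.+ L.- L.1#
    q⁻¹q≈1 : L.q⁻¹ L.* L.q L.≈ L.1#
    q⁻¹q≈1 = L.trans (L.*-comm L.q⁻¹ L.q) L.q-inv

module BarExpansion (C : FiniteCoxeterSystem) (L : LaurentRing) (HA : HeckeAlgebra C L)
                    (BI : BarInvolution C L HA) where
  private
    module C = FiniteCoxeterSystem C
    module L = LaurentRing L
    module ι = RingMorphisms.IsRingHomomorphism (HeckeAlgebra.ι-hom HA)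
    module D = RingMorphisms.IsRingHomomorphism (BarInvolution.D-hom BI)
  open HeckeAlgebra HA
  open BarInvolution BI using (D; D-T-left)
  open CoxeterProperties C
  open Coefficients C L
  open HeckeQuadratic C L HA
  open FiniteSums C.setoid semiring
  open MonoidProperties *-monoid using (insertʳ; elimˡ)
  open import Relation.Binary.Reasoning.Setoid setoid

  D-T-s : ∀ i → D (T (C.s i)) ≈ T-s⁻¹ i
  D-T-s i = trans (insertʳ (T-s-*-T-s⁻¹ i) _) (elimˡ D-T-s-*-T-s _)
    where
    D-T-s-*-T-s : D (T (C.s i)) * T (C.s i) ≈ 1#
    D-T-s-*-T-s = trans (*-congˡ (T-cong (C.sym (s-self-inverse i)))) (D-T-left (C.s i))

  T-s-*-D-T-s : ∀ i → T (C.s i) * D (T (C.s i)) ≈ 1#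
  T-s-*-D-T-s i = trans (*-congˡ (D-T-s i)) (T-s-*-T-s⁻¹ i)

  T-*-D-T-s-descent : ∀ {i u} → IsDescent i u → T u * D (T (C.s i)) ≈ T (u C.∙ C.s i)
  T-*-D-T-s-descent {i} {u} d = begin
    T u * D t                              ≈⟨ *-congʳ (T-cong (C.sym (∙s-involutive u i))) ⟩
    T ((u C.∙ C.s i) C.∙ C.s i) * D t      ≈⟨ *-congʳ (T-long (u C.∙ C.s i) i (ascent-< (descent⇒ascent d))) ⟨
    (T (u C.∙ C.s i) * t) * D t            ≈⟨ *-assoc _ t (D t) ⟩
    T (u C.∙ C.s i) * (t * D t)            ≈⟨ *-congˡ (T-s-*-D-T-s i) ⟩
    T (u C.∙ C.s i) * 1#                   ≈⟨ *-identityʳ _ ⟩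
    T (u C.∙ C.s i)                        ∎
    where
    t = T (C.s i)

  T-*-D-T-s-ascent : ∀ {i u} → ¬ IsDescent i u →
    T u * D (T (C.s i)) ≈ ι L.q⁻¹ * T (u C.∙ C.s i) + ι (L.q⁻¹ L.+ L.- L.1#) * T u
  T-*-D-T-s-ascent {i} {u} ¬d = begin
    T u * D t                              ≈⟨ *-congˡ (D-T-s i) ⟩
    T u * (ι L.q⁻¹ * t + ι b)              ≈⟨ distribˡ (T u) _ _ ⟩
    T u * (ι L.q⁻¹ * t) + T u * ι b        ≈⟨ +-cong (*-ι-comm (T u) L.q⁻¹ t) (sym (ι-central b (T u))) ⟩
    ι L.q⁻¹ * (T u * t) + ι b * T u        ≈⟨ +-congʳ (*-congˡ (T-long u i (ascent-< ¬d))) ⟩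
    ι L.q⁻¹ * T (u C.∙ C.s i) + ι b * T u  ∎
    where
    t = T (C.s i)
    b = L.q⁻¹ L.+ L.- L.1#

  T-*-D-T-s : ∀ i u →
    T u * D (T (C.s i)) ≈ ι (α (descent? i u)) * T (u C.∙ C.s i) + ι (β (descent? i u)) * T u
  T-*-D-T-s i u = by-descent (descent? i u)
    where
    by-descent : (d : Dec (IsDescent i u)) →
      T u * D (T (C.s i)) ≈ ι (α d) * T (u C.∙ C.s i) + ι (β d) * T u
    by-descent (no ¬d) = T-*-D-T-s-ascent ¬d
    by-descent (yes d) = begin
      T u * D (T (C.s i))                          ≈⟨ T-*-D-T-s-descent d ⟩
      T (u C.∙ C.s i)                              ≈⟨ +-identityʳ _ ⟨
      T (u C.∙ C.s i) + 0#
        ≈⟨ +-cong (trans (*-congʳ ι.1#-homo) (*-identityˡ _)) (trans (*-congʳ ι.0#-homo) (zeroˡ _)) ⟨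
      ι L.1# * T (u C.∙ C.s i) + ι L.0# * T u      ∎

  sum-elements-∙ʳ : ∀ {F} → F Preserves C._≈_ ⟶ _≈_ → ∀ g →
    sum F C.elements ≈ sum (λ u → F (u C.∙ g)) C.elements
  sum-elements-∙ʳ {F} F-resp g =
    trans (sym (sum-↭ F-resp (∙ʳ-permutes-elements g))) (reflexive (sum-map F (C._∙ g) C.elements))

  term : List (Fin C.rank) → C.Carrier → Carrier
  term rw u = ι (coefficient rw u) * T u

  term-cong : ∀ rw → term rw Preserves C._≈_ ⟶ _≈_
  term-cong rw u≈v = *-cong (ι-cong (coefficient-cong rw u≈v)) (T-cong u≈v)

  sum-term-*-D-T-s : ∀ i rw → sum (term rw) C.elements * D (T (C.s i)) ≈ sum (term (i ∷ rw)) C.elements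
  sum-term-*-D-T-s i rw = begin
    sum (term rw) C.elements * D t                        ≈⟨ *-distribʳ-sum (term rw) (D t) C.elements ⟩
    sum (λ u → term rw u * D t) C.elements                ≈⟨ sum-cong split C.elements ⟩
    sum (λ u → shifted u + diagonal u) C.elements         ≈⟨ sum-distrib-+ shifted diagonal C.elements ⟨
    sum shifted C.elements + sum diagonal C.elements      ≈⟨ +-congʳ (sum-elements-∙ʳ shifted-cong (C.s i)) ⟩
    sum (shifted ∘ (C._∙ C.s i)) C.elements + sum diagonal C.elements
                                                          ≈⟨ sum-distrib-+ _ diagonal C.elements ⟩
    sum (λ v → shifted (v C.∙ C.s i) + diagonal v) C.elements ≈⟨ sum-cong collect C.elements ⟩
    sum (term (i ∷ rw)) C.elements                        ∎
    where
    t = T (C.s i)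
    shifted diagonal : C.Carrier → Carrier
    shifted u = ι (coefficient rw u L.* α (descent? i u)) * T (u C.∙ C.s i)
    diagonal u = ι (coefficient rw u L.* β (descent? i u)) * T u

    shifted-cong : shifted Preserves C._≈_ ⟶ _≈_
    shifted-cong u≈v = *-cong (ι-cong (L.*-cong (coefficient-cong rw u≈v) (L.reflexive (α-cong i u≈v))))
                              (T-cong (C.∙-congʳ u≈v))

    split : ∀ u → term rw u * D t ≈ shifted u + diagonal u
    split u = begin
      ι (coefficient rw u) * T u * D t
        ≈⟨ *-assoc _ (T u) (D t) ⟩
      ι (coefficient rw u) * (T u * D t)
        ≈⟨ *-congˡ (T-*-D-T-s i u) ⟩
      ι (coefficient rw u) * (ι (α (descent? i u)) * T (u C.∙ C.s i) + ι (β (descent? i u)) * T u)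
        ≈⟨ distribˡ _ _ _ ⟩
      ι (coefficient rw u) * (ι (α (descent? i u)) * T (u C.∙ C.s i))
        + ι (coefficient rw u) * (ι (β (descent? i u)) * T u)
        ≈⟨ +-cong (ι-*-assoc _ _ _) (ι-*-assoc _ _ _) ⟩
      shifted u + diagonal u ∎

    collect : ∀ v → shifted (v C.∙ C.s i) + diagonal v ≈ term (i ∷ rw) v
    collect v = begin
      shifted (v C.∙ C.s i) + diagonal v
        ≈⟨ +-congʳ (*-congˡ (T-cong (∙s-involutive v i))) ⟩
      ι (coefficient rw (v C.∙ C.s i) L.* α (descent? i (v C.∙ C.s i))) * T v + diagonal v
        ≈⟨ distribʳ (T v) _ _ ⟨
      (ι (coefficient rw (v C.∙ C.s i) L.* α (descent? i (v C.∙ C.s i)))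
        + ι (coefficient rw v L.* β (descent? i v))) * T v
        ≈⟨ *-congʳ (trans (sym (ι.+-homo _ _)) (ι-cong (coefficient-step i rw v))) ⟩
      term (i ∷ rw) v ∎

  Tword-∷ʳ : ∀ xs i → Tword (xs ++ i ∷ []) ≈ Tword xs * T (C.s i)
  Tword-∷ʳ [] i = trans (*-identityʳ _) (sym (*-identityˡ _))
  Tword-∷ʳ (j ∷ xs) i = trans (*-congˡ (Tword-∷ʳ xs i)) (sym (*-assoc _ _ _))

  D-Tword-reverse : ∀ rw → D (Tword (reverse rw)) ≈ sum (term rw) C.elements
  D-Tword-reverse [] = begin
    D 1#                      ≈⟨ D.1#-homo ⟩
    1#                        ≈⟨ trans (*-cong (trans (ι-cong coefficient-[]-ε) ι.1#-homo) T-unit) (*-identityˡ 1#) ⟨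
    term [] C.ε               ≈⟨ sum-unique-support (term-cong []) off-ε C.elements-distinct (C.elements-complete C.ε) ⟨
    sum (term []) C.elements  ∎
    where
    off-ε : ∀ {u} → ¬ C.ε C.≈ u → term [] u ≈ 0#
    off-ε ε≉u = trans (*-congʳ (trans (ι-cong (coefficient-[]-≉ε (ε≉u ∘ C.sym))) ι.0#-homo)) (zeroˡ _)
  D-Tword-reverse (i ∷ rw) = begin
    D (Tword (reverse (i ∷ rw)))          ≡⟨ ≡.cong (D ∘ Tword) (unfold-reverse i rw) ⟩
    D (Tword (reverse rw ++ i ∷ []))      ≈⟨ D.⟦⟧-cong (Tword-∷ʳ (reverse rw) i) ⟩
    D (Tword (reverse rw) * T (C.s i))    ≈⟨ D.*-homo _ _ ⟩
    D (Tword (reverse rw)) * D (T (C.s i)) ≈⟨ *-congʳ (D-Tword-reverse rw) ⟩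
    sum (term rw) C.elements * D (T (C.s i)) ≈⟨ sum-term-*-D-T-s i rw ⟩
    sum (term (i ∷ rw)) C.elements        ∎

  D-Tword : ∀ w → D (Tword w) ≈ sum (term (reverse w)) C.elements
  D-Tword w = ≡.subst (λ v → D (Tword v) ≈ sum (term (reverse w)) C.elements)
    (reverse-involutive w) (D-Tword-reverse (reverse w))

corollary5p2 : (C : FiniteCoxeterSystem) (L : LaurentRing) (HA : HeckeAlgebra C L)
    (BI : BarInvolution C L HA) (w : Word (FiniteCoxeterSystem.rank C)) →
    HeckeAlgebra._≈_ HA
      (BarInvolution.D BI (HeckeAlgebra.Tword HA w))
      (HeckeAlgebra.sumW HA (λ u →
        HeckeAlgebra._*_ HA
          (HeckeAlgebra.ι HA
            (LaurentRing._*_ L (R C L (LaurentRing.q⁻¹ L) u w)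
              (lpow L (FiniteCoxeterSystem.ℓ C u) (LaurentRing.q⁻¹ L))))
          (HeckeAlgebra.T HA u)))
corollary5p2 C L HA BI = BarExpansion.D-Tword C L HA BI
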